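{- For every integer $d\geq 0$, $\chi_{td}(Q_d)\leq 2^{d+1}-1$, where $Q_d$ is the $d$-dimensional hypercube graph.
   Context: For a graph $G$ and a positive integer $k$, a proper $k$-total difference labeling of $G$ is a function $f$ from $V(G)\cup E(G)$ to $\{1,2,\dots,k\}$ such that: (1) for every edge $\{u,v\}$, $f(\{u,v\})=|f(u)-f(v)|$; (2) adjacent vertices receive different labels; (3) two edges sharing a vertex receive different labels; (4) no edge receives the same label as one of its endpoints. $\chi_{td}(G)$ denotes the smallest $k$ for which $G$ has a proper $k$-total difference labeling. The hypercube graph $Q_d$ has vertex set $\{0,1\}^d$, two vertices being adjacent iff they differ in exactly one coordinate; $Q_0$ is a single vertex. -}

module Defs where

open import Data.Nat using (ℕ; zero; suc; _≤_; _+_)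
open import Data.Nat.Base using (∣_-_∣)
open import Data.Bool using (Bool)
open import Data.Vec using (Vec; []; _∷_)
open import Data.Product using (_×_; Σ)
open import Relation.Binary.PropositionalEquality using (_≡_; _≢_)
open import Relation.Nullary using (¬_)

hamming : ∀ {d} → Vec Bool d → Vec Bool d → ℕ
hamming [] [] = 0
hamming (x ∷ xs) (y ∷ ys) with x Data.Bool.≟ y
... | Relation.Nullary.yes _ = hamming xs ys
... | Relation.Nullary.no  _ = suc (hamming xs ys)

record Graph : Set₁ where
  field
    V   : Set
    Adj : V → V → Set

Q : ℕ → Graph
Q d = record { V = Vec Bool d ; Adj = λ u v → hamming u v ≡ 1 }

-- A proper k-total difference labeling of G, given by the vertex labels f;
-- the edge {u,v} is labelled by |f u - f v|, as condition (1) forces.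
record IsProperTDL (G : Graph) (k : ℕ) (f : Graph.V G → ℕ) : Set where
  open Graph G
  edgeLabel : V → V → ℕ
  edgeLabel u v = ∣ f u - f v ∣
  field
    vertexRange : ∀ v → 1 ≤ f v × f v ≤ k
    edgeRange   : ∀ u v → Adj u v → 1 ≤ edgeLabel u v × edgeLabel u v ≤ k
    adjDistinct : ∀ u v → Adj u v → f u ≢ f v
    edgeDistinct : ∀ u v w → Adj u v → Adj u w → v ≢ w → edgeLabel u v ≢ edgeLabel u w
    edgeVertex  : ∀ u v → Adj u v → edgeLabel u v ≢ f u

HasProperTDL : Graph → ℕ → Set
HasProperTDL G k = Σ (Graph.V G → ℕ) (IsProperTDL G k)

-- χ_td(G) ≤ k  (χ_td is the least k admitting a labeling, so this is equivalent
-- to the existence of a proper k-total difference labeling)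
χtd≤ : Graph → ℕ → Set
χtd≤ G k = HasProperTDL G k

-- Label the vertex u of Q_d by 1 + 2 b(u), where b(u) < 2^d is the number whose
-- binary digits are u. Vertex labels are then odd and at most 2^(d+1) - 1. The
-- neighbours of u are obtained by flipping one coordinate i, and the edge to
-- such a neighbour gets the even label 2 · 2^i, which is nonzero, differs from
-- every vertex label, and determines i.
module Submission where

open import Defs
open import Data.Nat using (ℕ; zero; suc; _+_; _*_; _∸_; _^_; ∣_-_∣; _≤_; _<_; z≤n; s≤s)
open import Data.Nat.Properties
  using ( +-comm; *-suc; *-monoʳ-≤; *-monoʳ-<; ^-monoʳ-<; ∸-monoˡ-≤; m^n>0; n<1+n
        ; suc-injective; <-cmp; <⇒≢; even≢odd
        ; ∣-∣-comm; ∣m+n-m+o∣≡∣n-o∣; *-distribˡ-∣-∣; m≡n⇒∣m-n∣≡0 )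
open import Data.Bool using (Bool; true; false; not; _≟_)
open import Data.Bool.Properties using (¬-not)
open import Data.Fin using (Fin; zero; suc; toℕ)
open import Data.Fin.Properties using (toℕ-injective; toℕ<n)
open import Data.Vec using (Vec; []; _∷_; _[_]%=_)
open import Data.Product using (Σ; _×_; _,_)
open import Relation.Binary using (tri<; tri≈; tri>)
open import Relation.Binary.PropositionalEquality
open import Relation.Nullary using (yes; no; contradiction)

private
  variable
    d m n : ℕ

bitValue : Bool → ℕ
bitValue false = 0
bitValue true  = 1

binaryValue : Vec Bool d → ℕ
binaryValue []      = 0
binaryValue (b ∷ u) = bitValue b + 2 * binaryValue u

m<n⇒1+2m<2n : m < n → suc (2 * m) < 2 * n
m<n⇒1+2m<2n {m} {n} m<n = subst (_≤ 2 * n) (*-suc 2 m) (*-monoʳ-≤ 2 m<n)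

binaryValue<2^d : (u : Vec Bool d) → binaryValue u < 2 ^ d
binaryValue<2^d []          = s≤s z≤n
binaryValue<2^d (false ∷ u) = *-monoʳ-< 2 (binaryValue<2^d u)
binaryValue<2^d (true ∷ u)  = m<n⇒1+2m<2n (binaryValue<2^d u)

∣n-1+n∣≡1 : ∀ n → ∣ n - suc n ∣ ≡ 1
∣n-1+n∣≡1 zero    = refl
∣n-1+n∣≡1 (suc n) = ∣n-1+n∣≡1 n

∣binaryValue-binaryValue∘flip∣ : (u : Vec Bool d) (i : Fin d) →
                                 ∣ binaryValue u - binaryValue (u [ i ]%= not) ∣ ≡ 2 ^ toℕ i
∣binaryValue-binaryValue∘flip∣ (false ∷ u) zero = ∣n-1+n∣≡1 (2 * binaryValue u)
∣binaryValue-binaryValue∘flip∣ (true ∷ u)  zero =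
  trans (∣-∣-comm (suc (2 * binaryValue u)) (2 * binaryValue u)) (∣n-1+n∣≡1 (2 * binaryValue u))
∣binaryValue-binaryValue∘flip∣ (b ∷ u) (suc i) = begin
  ∣ bitValue b + 2 * binaryValue u - bitValue b + 2 * binaryValue (u [ i ]%= not) ∣
    ≡⟨ ∣m+n-m+o∣≡∣n-o∣ (bitValue b) (2 * binaryValue u) _ ⟩
  ∣ 2 * binaryValue u - 2 * binaryValue (u [ i ]%= not) ∣
    ≡⟨ *-distribˡ-∣-∣ 2 (binaryValue u) _ ⟨
  2 * ∣ binaryValue u - binaryValue (u [ i ]%= not) ∣
    ≡⟨ cong (2 *_) (∣binaryValue-binaryValue∘flip∣ u i) ⟩
  2 * 2 ^ toℕ i ∎
  where open ≡-Reasoning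

hamming≡0⇒≡ : (u v : Vec Bool d) → hamming u v ≡ 0 → u ≡ v
hamming≡0⇒≡ []      []      _ = refl
hamming≡0⇒≡ (a ∷ u) (b ∷ v) h with a ≟ b
... | yes refl = cong (a ∷_) (hamming≡0⇒≡ u v h)

hamming≡1⇒flip : (u v : Vec Bool d) → hamming u v ≡ 1 → Σ (Fin d) λ i → v ≡ u [ i ]%= not
hamming≡1⇒flip []      []      ()
hamming≡1⇒flip (a ∷ u) (b ∷ v) h with a ≟ b
... | yes refl with i , v≡flip ← hamming≡1⇒flip u v h = suc i , cong (a ∷_) v≡flip
... | no a≢b = zero , cong₂ _∷_ (¬-not (≢-sym a≢b)) (sym (hamming≡0⇒≡ u v (suc-injective h)))

2^-injective : 2 ^ m ≡ 2 ^ n → m ≡ n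
2^-injective {m} {n} eq with <-cmp m n
... | tri< m<n _ _ = contradiction eq (<⇒≢ (^-monoʳ-< 2 (n<1+n 1) m<n))
... | tri≈ _ m≡n _ = m≡n
... | tri> _ _ n<m = contradiction (sym eq) (<⇒≢ (^-monoʳ-< 2 (n<1+n 1) n<m))

label : Vec Bool d → ℕ
label u = suc (2 * binaryValue u)

label<2^[1+d] : (u : Vec Bool d) → label u < 2 ^ suc d
label<2^[1+d] u = m<n⇒1+2m<2n (binaryValue<2^d u)

∣label-label∘flip∣ : (u : Vec Bool d) (i : Fin d) →
                     ∣ label u - label (u [ i ]%= not) ∣ ≡ 2 ^ suc (toℕ i)
∣label-label∘flip∣ u i = begin
  ∣ 2 * binaryValue u - 2 * binaryValue (u [ i ]%= not) ∣
    ≡⟨ *-distribˡ-∣-∣ 2 (binaryValue u) _ ⟨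
  2 * ∣ binaryValue u - binaryValue (u [ i ]%= not) ∣
    ≡⟨ cong (2 *_) (∣binaryValue-binaryValue∘flip∣ u i) ⟩
  2 * 2 ^ toℕ i ∎
  where open ≡-Reasoning

label-isProperTDL : (d : ℕ) → IsProperTDL (Q d) (2 ^ suc d ∸ 1) label
label-isProperTDL d = record
  { vertexRange  = λ u → s≤s z≤n , ∸-monoˡ-≤ 1 (label<2^[1+d] u)
  ; edgeRange    = λ u v adj → let i , ℓ≡ , _ = neighbour u v adj in
      subst (λ ℓ → 1 ≤ ℓ × ℓ ≤ 2 ^ suc d ∸ 1) (sym ℓ≡)
            (m^n>0 2 (suc (toℕ i)) , ∸-monoˡ-≤ 1 (^-monoʳ-< 2 (n<1+n 1) (s≤s (toℕ<n i))))
  ; adjDistinct  = λ u v adj u≡v → let i , ℓ≡ , _ = neighbour u v adj in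
      <⇒≢ (m^n>0 2 (suc (toℕ i))) (trans (sym (m≡n⇒∣m-n∣≡0 u≡v)) ℓ≡)
  ; edgeDistinct = λ u v w adj₁ adj₂ v≢w ℓ≡ℓ →
      let i , ℓ≡₁ , v≡ = neighbour u v adj₁
          j , ℓ≡₂ , w≡ = neighbour u w adj₂
          i≡j = toℕ-injective (suc-injective (2^-injective (trans (sym ℓ≡₁) (trans ℓ≡ℓ ℓ≡₂))))
      in v≢w (trans v≡ (trans (cong (u [_]%= not) i≡j) (sym w≡)))
  ; edgeVertex   = λ u v adj ℓ≡label → let i , ℓ≡ , _ = neighbour u v adj in
      even≢odd (2 ^ toℕ i) (binaryValue u) (trans (sym ℓ≡) ℓ≡label)
  }
  where
  neighbour : (u v : Vec Bool d) → hamming u v ≡ 1 →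
              Σ (Fin d) λ i → ∣ label u - label v ∣ ≡ 2 ^ suc (toℕ i) × v ≡ u [ i ]%= not
  neighbour u v adj with i , refl ← hamming≡1⇒flip u v adj = i , ∣label-label∘flip∣ u i , refl

mainTheorem9 : (d : ℕ) → χtd≤ (Q d) (2 ^ (d + 1) ∸ 1)
mainTheorem9 d rewrite +-comm d 1 = label , label-isProperTDL d
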